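{- Let $G=(V,E)$ be a triangle-free graph that contains no dominated vertices and for which $\gamma(G) \geq 3$. Then $cc(G) > 2$.
   Context: All graphs are finite, reflexive and connected. In the Cops and Attacking Robbers game, play is as in Cops and Robbers, except that if the robber moves onto a vertex occupied by a cop, one such cop is removed from the game; $cc(G)$ denotes the attacking cop number of $G$, the least number of cops that have a strategy guaranteeing capture of the robber in this game on $G$. A vertex $u$ is dominated (by $v \neq u$) if $N(u) \subseteq N[v]$. $\gamma$ denotes the domination number. -}

module Defs where

open import Data.Nat using (ℕ; _≤_)
open import Data.Fin using (Fin; _≟_)
open import Data.List using (List; []; _∷_; length)
open import Data.List.Membership.Propositional using (_∈_; _∉_)
open import Data.List.Relation.Binary.Pointwise using (Pointwise)
open import Data.Product using (Σ; ∃; ∃-syntax; _×_; _,_)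
open import Data.Sum using (_⊎_)
open import Data.Empty using (⊥)
open import Relation.Nullary using (¬_; yes; no)
open import Relation.Binary.PropositionalEquality using (_≡_; _≢_)
open import Relation.Binary.Definitions using (Decidable)
open import Relation.Binary.Construct.Closure.ReflexiveTransitive using (Star)

record Graph : Set₁ where
  field
    n       : ℕ
    Adj     : Fin n → Fin n → Set
    adj?    : Decidable Adj
    refl    : ∀ v → Adj v v
    sym     : ∀ {u v} → Adj u v → Adj v u
    connected : ∀ u v → Star Adj u v

module _ (G : Graph) where
  open Graph G

  V : Set
  V = Fin n

  TriangleFree : Set
  TriangleFree = ∀ a b c → a ≢ b → b ≢ c → a ≢ c →
                 Adj a b → Adj b c → Adj a c → ⊥

  InN : V → V → Set
  InN u w = w ≢ u × Adj u w

  InN[] : V → V → Set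
  InN[] v w = Adj v w     -- the graph is reflexive, so v ∈ N[v]

  Dominated : V → Set
  Dominated u = ∃[ v ] (v ≢ u × (∀ w → InN u w → InN[] v w))

  NoDominatedVertices : Set
  NoDominatedVertices = ∀ u → ¬ Dominated u

  Dominating : List V → Set
  Dominating D = ∀ v → ∃[ d ] (d ∈ D × InN[] d v)

  DominationNumber≥ : ℕ → Set
  DominationNumber≥ k = ∀ (D : List V) → Dominating D → k ≤ length D

  -- Cops and Attacking Robbers.
  -- Cop positions are a list (a multiset) of vertices.

  removeOne : V → List V → List V
  removeOne x [] = []
  removeOne x (y ∷ ys) with x ≟ y
  ... | yes _ = ys
  ... | no  _ = y ∷ removeOne x ys

  -- a cops' move: every remaining cop moves to a vertex of its closed
  -- neighbourhood (staying put allowed by reflexivity)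
  CopsMove : List V → List V → Set
  CopsMove cs cs' = Pointwise Adj cs cs'

  -- CopsWin cs r : it is the cops' turn, cops are at cs, the robber at r
  -- (not on a cop); the cops can force capture in finitely many rounds.
  data CopsWin (cs : List V) (r : V) : Set
  AfterRobber : List V → V → Set

  data CopsWin cs r where
    capture : ∀ cs' → CopsMove cs cs' → r ∈ cs' → CopsWin cs r
    play    : ∀ cs' → CopsMove cs cs' → r ∉ cs' →
              (∀ r' → Adj r r' → AfterRobber cs' r') → CopsWin cs r

  -- If the robber moves onto a cop, one such cop is removed; if a cop
  -- still occupies the robber's vertex the robber is captured.
  AfterRobber cs r' =
      (r' ∈ cs × (r' ∈ removeOne r' cs ⊎ CopsWin (removeOne r' cs) r'))
    ⊎ (r' ∉ cs × CopsWin cs r')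

  -- k cops have a winning strategy: they choose initial positions, then
  -- the robber chooses a vertex (captured if it is occupied), then play.
  CopsCanWin : ℕ → Set
  CopsCanWin k = ∃[ cs ] (length cs ≡ k ×
                   (∀ r → r ∈ cs ⊎ CopsWin cs r))

  AttackingCopNumber> : ℕ → Set
  AttackingCopNumber> m = ∀ k → k ≤ m → ¬ CopsCanWin k

{-# OPTIONS --safe #-}
-- The robber keeps the invariant that, whenever the cops are to move, no cop is
-- adjacent to (or on) his vertex r; then the cops can never capture him.  Two cops
-- do not dominate G since γ(G) ≥ 3, so he can start in such a position.  When,
-- after the cops' move, a cop c is adjacent to him, either the other cop c' is
-- not adjacent to c and he attacks c, or c' is adjacent to c: as c' does not
-- dominate r, some neighbour w of r lies outside N[c'], and w lies outside N[c]
-- as well because G is triangle-free; he escapes to w.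
module Submission where

open import Defs
open import Data.Nat using (ℕ; suc; _≤_; s≤s)
open import Data.Nat.Properties using (≤-refl; ≤-trans; m≤n⇒m≤1+n; ≤⇒≯)
open import Data.Fin using (_≟_)
open import Data.Fin.Properties using (¬∀⟶∃¬)
open import Data.List using (List; []; _∷_; length)
open import Data.List.Membership.Propositional using (_∈_; _∉_; find)
open import Data.List.Relation.Unary.Any using (Any; here; there; any?)
open import Data.List.Relation.Unary.All using (All; []; _∷_)
open import Data.List.Relation.Unary.All.Properties using (¬Any⇒All¬)
open import Data.List.Relation.Binary.Pointwise using (_∷_; Pointwise-length)
open import Data.Product using (∃-syntax; _×_; _,_; map₂)
open import Data.Sum using (_⊎_; inj₁; inj₂; [_,_]′)
open import Data.Empty using (⊥-elim)
open import Function using (_∘_)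
open import Relation.Nullary using (¬_; Dec; yes; no)
open import Relation.Nullary.Decidable using (¬?; _×-dec_; _→-dec_; decidable-stable)
open import Relation.Binary.PropositionalEquality as ≡ using (_≡_; _≢_; refl; subst; cong; ≢-sym)

removeOne-head : ∀ (G : Graph) x xs → removeOne G x (x ∷ xs) ≡ xs
removeOne-head G x xs with x ≟ x
... | yes _  = refl
... | no x≢x = ⊥-elim (x≢x refl)

removeOne-second : ∀ (G : Graph) x y → removeOne G x (y ∷ x ∷ []) ≡ y ∷ []
removeOne-second G x y with x ≟ y
... | yes refl = refl
... | no _     = cong (y ∷_) (removeOne-head G x [])

removeOne-length : ∀ (G : Graph) x xs → length (removeOne G x xs) ≤ length xs
removeOne-length G x []       = ≤-refl
removeOne-length G x (y ∷ ys) with x ≟ y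
... | yes _ = m≤n⇒m≤1+n ≤-refl
... | no _  = s≤s (removeOne-length G x ys)

module _ (G : Graph) where
  open Graph G using (n; Adj; adj?) renaming (refl to adj-refl; sym to adj-sym)

  OutOfReach : List (V G) → V G → Set
  OutOfReach cs r = All (λ c → ¬ Adj c r) cs

  OutOfReach⇒∉ : ∀ {cs r} → OutOfReach cs r → r ∉ cs
  OutOfReach⇒∉ (c≁r ∷ _)   (here refl) = c≁r (adj-refl _)
  OutOfReach⇒∉ (_ ∷ c≁r*) (there r∈)  = OutOfReach⇒∉ c≁r* r∈

  OutOfReach⇒∉-after-move : ∀ {cs cs' r} → CopsMove G cs cs' → OutOfReach cs r → r ∉ cs'
  OutOfReach⇒∉-after-move (c~c' ∷ _) (c≁r ∷ _)   (here refl) = c≁r c~c'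
  OutOfReach⇒∉-after-move (_ ∷ moves) (_ ∷ c≁r*) (there r∈)  =
    OutOfReach⇒∉-after-move moves c≁r* r∈

  SafeReply : List (V G) → V G → Set
  SafeReply cs r' = OutOfReach cs r' ⊎ (r' ∈ cs × OutOfReach (removeOne G r' cs) r')

  RobberReplies : ℕ → Set
  RobberReplies k = ∀ cs r → length cs ≤ k → r ∉ cs → ∃[ r' ] (Adj r r' × SafeReply cs r')

  module _ {k : ℕ} (reply : RobberReplies k) where
    mutual
      copsLose : ∀ {cs r} → length cs ≤ k → OutOfReach cs r → ¬ CopsWin G cs r
      copsLose _   out (capture _ move r∈) = OutOfReach⇒∉-after-move move out r∈
      copsLose {r = r} len out (play cs' move r∉ next) = robberEscapes (reply cs' r len' r∉)
        where
        len' : length cs' ≤ k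
        len' = subst (_≤ k) (Pointwise-length move) len

        robberEscapes : ¬ (∃[ r' ] (Adj r r' × SafeReply cs' r'))
        robberEscapes (r' , r~r' , safe) = copsLoseAfter len' safe (next r' r~r')

      copsLoseAfter : ∀ {cs r} → length cs ≤ k → SafeReply cs r → ¬ AfterRobber G cs r
      copsLoseAfter _   (inj₁ out)      (inj₁ (r∈ , _))       = OutOfReach⇒∉ out r∈
      copsLoseAfter len (inj₁ out)      (inj₂ (_ , win))      = copsLose len out win
      copsLoseAfter _   (inj₂ (r∈ , _)) (inj₂ (r∉ , _))       = r∉ r∈
      copsLoseAfter _   (inj₂ (_ , out)) (inj₁ (_ , inj₁ r∈)) = OutOfReach⇒∉ out r∈
      copsLoseAfter {cs} {r} len (inj₂ (_ , out)) (inj₁ (_ , inj₂ win)) =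
        copsLose (≤-trans (removeOne-length G r cs) len) out win

  unguardedVertex : ∀ {k cs} → DominationNumber≥ G (suc k) → length cs ≤ k →
                    ∃[ v ] OutOfReach cs v
  unguardedVertex {cs = cs} γ>k len =
    map₂ (¬Any⇒All¬ cs) (¬∀⟶∃¬ n Guarded (λ v → any? (λ c → adj? c v) cs) notDominating)
    where
    Guarded : V G → Set
    Guarded v = Any (λ c → Adj c v) cs

    notDominating : ¬ (∀ v → Guarded v)
    notDominating guarded = ≤⇒≯ len (γ>k cs (find ∘ guarded))

  undominated⇒neighbour-outside : ∀ {r c} → ¬ Dominated G r → c ≢ r →
                                  ∃[ w ] (InN G r w × ¬ Adj c w)
  undominated⇒neighbour-outside {r} {c} r-undominated c≢r =
    map₂ split (¬∀⟶∃¬ n Covered (λ w → InN? w →-dec adj? c w)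
                              (λ covered → r-undominated (c , c≢r , covered)))
    where
    Covered : V G → Set
    Covered w = InN G r w → Adj c w

    InN? : ∀ w → Dec (InN G r w)
    InN? w = ¬? (w ≟ r) ×-dec adj? r w

    split : ∀ {w} → ¬ Covered w → InN G r w × ¬ Adj c w
    split {w} uncovered =
      decidable-stable (InN? w) (λ w∉N → uncovered (⊥-elim ∘ w∉N)) ,
      uncovered ∘ λ c~w _ → c~w

  escapeTwoAdjacentCops : TriangleFree G → ∀ {r c₁ c₂} → ¬ Dominated G r →
                          c₁ ≢ r → c₂ ≢ r → Adj c₁ r → Adj c₁ c₂ →
                          ∃[ w ] (Adj r w × ¬ Adj c₁ w × ¬ Adj c₂ w)
  escapeTwoAdjacentCops tf {r} {c₁} r-undominated c₁≢r c₂≢r c₁~r c₁~c₂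
    with undominated⇒neighbour-outside r-undominated c₂≢r
  ... | w , (w≢r , r~w) , c₂≁w = w , r~w , c₁≁w , c₂≁w
    where
    c₁≁w : ¬ Adj c₁ w
    c₁≁w c₁~w with w ≟ c₁
    ... | yes refl = c₂≁w (adj-sym c₁~c₂)
    ... | no w≢c₁  =
      tf r c₁ w (≢-sym c₁≢r) (≢-sym w≢c₁) (≢-sym w≢r) (adj-sym c₁~r) c₁~w r~w

  evadeOrAttack : TriangleFree G → ∀ {r c₁ c₂} → ¬ Dominated G r →
                  c₁ ≢ r → c₂ ≢ r → Adj c₁ r →
                  ∃[ r' ] (Adj r r' × ((¬ Adj c₁ r' × ¬ Adj c₂ r') ⊎ (r' ≡ c₁ × ¬ Adj c₂ c₁)))
  evadeOrAttack tf {c₁ = c₁} {c₂} r-undominated c₁≢r c₂≢r c₁~r with adj? c₁ c₂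
  ... | no c₁≁c₂ = c₁ , adj-sym c₁~r , inj₂ (refl , c₁≁c₂ ∘ adj-sym)
  ... | yes c₁~c₂ =
    map₂ (map₂ inj₁) (escapeTwoAdjacentCops tf r-undominated c₁≢r c₂≢r c₁~r c₁~c₂)

  attackLone : ∀ c → SafeReply (c ∷ []) c
  attackLone c =
    inj₂ (here refl , subst (λ cs → OutOfReach cs c) (≡.sym (removeOne-head G c [])) [])

  attackFirst : ∀ {c₁ c₂} → ¬ Adj c₂ c₁ → SafeReply (c₁ ∷ c₂ ∷ []) c₁
  attackFirst {c₁} {c₂} c₂≁c₁ =
    inj₂ (here refl ,
          subst (λ cs → OutOfReach cs c₁) (≡.sym (removeOne-head G c₁ _)) (c₂≁c₁ ∷ []))

  attackSecond : ∀ {c₁ c₂} → ¬ Adj c₁ c₂ → SafeReply (c₁ ∷ c₂ ∷ []) c₂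
  attackSecond {c₁} {c₂} c₁≁c₂ =
    inj₂ (there (here refl) ,
          subst (λ cs → OutOfReach cs c₂) (≡.sym (removeOne-second G c₂ c₁)) (c₁≁c₂ ∷ []))

  robberRepliesToTwo : TriangleFree G → NoDominatedVertices G → RobberReplies 2
  robberRepliesToTwo tf nd [] r _ _ = r , adj-refl r , inj₁ []
  robberRepliesToTwo tf nd (c ∷ []) r _ _ with adj? c r
  ... | no c≁r = r , adj-refl r , inj₁ (c≁r ∷ [])
  ... | yes c~r = c , adj-sym c~r , attackLone c
  robberRepliesToTwo tf nd (c₁ ∷ c₂ ∷ []) r _ r∉ with adj? c₁ r | adj? c₂ r
  ... | no c₁≁r | no c₂≁r = r , adj-refl r , inj₁ (c₁≁r ∷ c₂≁r ∷ [])
  ... | yes c₁~r | _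
    with evadeOrAttack tf (nd r) (r∉ ∘ here ∘ ≡.sym) (r∉ ∘ there ∘ here ∘ ≡.sym) c₁~r
  ...   | w , r~w , inj₁ (c₁≁w , c₂≁w)   = w , r~w , inj₁ (c₁≁w ∷ c₂≁w ∷ [])
  ...   | _ , r~c₁ , inj₂ (refl , c₂≁c₁) = c₁ , r~c₁ , attackFirst c₂≁c₁
  robberRepliesToTwo tf nd (c₁ ∷ c₂ ∷ []) r _ r∉ | no _ | yes c₂~r
    with evadeOrAttack tf (nd r) (r∉ ∘ there ∘ here ∘ ≡.sym) (r∉ ∘ here ∘ ≡.sym) c₂~r
  ...   | w , r~w , inj₁ (c₂≁w , c₁≁w)   = w , r~w , inj₁ (c₁≁w ∷ c₂≁w ∷ [])
  ...   | _ , r~c₂ , inj₂ (refl , c₁≁c₂) = c₂ , r~c₂ , attackSecond c₁≁c₂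
  robberRepliesToTwo tf nd (_ ∷ _ ∷ _ ∷ _) _ (s≤s (s≤s ())) _

mainTheorem2 : (G : Graph) → TriangleFree G → NoDominatedVertices G →
               DominationNumber≥ G 3 → AttackingCopNumber> G 2
mainTheorem2 G tf nd γ≥3 _ k≤2 (cs , refl , copsWin) with unguardedVertex G γ≥3 k≤2
... | v , out =
  [ OutOfReach⇒∉ G out , copsLose G (robberRepliesToTwo G tf nd) k≤2 out ]′ (copsWin v)
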